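{- Let $G$ be a graph of order $n$ such that $E_{c}(G,x)=E_{c}(K_{n},x)$. Then $G=K_{n}$.
   Context: All graphs are finite and simple; $K_n$ is the complete graph on $n$ vertices. For a graph $G$ with $m$ edges, a connected edge cover set is a subset $S$ of edges such that every vertex of $G$ is incident to at least one edge of $S$ and the subgraph induced by $S$ (the edges of $S$ with their endpoints) is connected; $e_c(G,i)$ is the number of connected edge cover sets of size $i$, and $E_{c}(G,x)=\sum_{i=1}^{m} e_{c}(G,i)x^{i}$. -}

module Defs where

open import Data.Bool using (Bool; true; false; _∧_; _∨_; not)
open import Data.Nat using (ℕ; zero; suc; _≡ᵇ_)
open import Data.Fin using (Fin; _≟_; _<?_)
open import Data.Product using (_×_; _,_; proj₁; proj₂)
open import Data.List using (List; []; _∷_; map; filterᵇ; length; concatMap; _++_; allFin)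
open import Data.Bool.ListAction using (any; all)
open import Data.Empty using (⊥-elim)
open import Relation.Nullary using (yes; no)
open import Relation.Nullary.Decidable using (⌊_⌋)
open import Relation.Binary.PropositionalEquality using (_≡_; refl; sym)

_==_ : ∀ {n} → Fin n → Fin n → Bool
u == v = ⌊ u ≟ v ⌋

record Graph (n : ℕ) : Set where
  field
    adj   : Fin n → Fin n → Bool
    adj-sym   : ∀ u v → adj u v ≡ adj v u
    adj-irref : ∀ v → adj v v ≡ false
open Graph public

K : (n : ℕ) → Graph n
K n = record { adj = λ u v → not (u == v) ; adj-sym = symK ; adj-irref = irrK }
  where
  symK : ∀ u v → not (u == v) ≡ not (v == u)
  symK u v with u ≟ v | v ≟ u
  ... | yes _ | yes _ = refl
  ... | no _  | no _  = refl
  ... | yes p | no q  = ⊥-elim (q (sym p))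
  ... | no p  | yes q = ⊥-elim (p (sym q))
  irrK : ∀ v → not (v == v) ≡ false
  irrK v with v ≟ v
  ... | yes _ = refl
  ... | no ¬p = ⊥-elim (¬p refl)

-- An edge {u,v} is represented canonically as the pair (u , v) with u < v.
Edge : ℕ → Set
Edge n = Fin n × Fin n

edges : ∀ {n} → Graph n → List (Edge n)
edges {n} G =
  concatMap (λ u → map (λ v → (u , v))
                       (filterᵇ (λ v → ⌊ u <? v ⌋ ∧ adj G u v) (allFin n)))
            (allFin n)

-- All sub-lists (= all subsets) of a list; for a duplicate-free list each
-- subset appears exactly once.
sublists : ∀ {A : Set} → List A → List (List A)
sublists []       = [] ∷ []
sublists (x ∷ xs) = sublists xs ++ map (x ∷_) (sublists xs)

incident : ∀ {n} → Edge n → Fin n → Bool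
incident (a , b) v = (a == v) ∨ (b == v)

covers : ∀ {n} → List (Edge n) → Bool
covers {n} S = all (λ v → any (λ e → incident e v) S) (allFin n)

step : ∀ {n} → List (Edge n) → (Fin n → Bool) → Fin n → Bool
step S R v = R v ∨ any (λ { (a , b) → ((a == v) ∧ R b) ∨ ((b == v) ∧ R a) }) S

reach : ∀ {n} → List (Edge n) → Fin n → ℕ → Fin n → Bool
reach S u zero    v = u == v
reach S u (suc k) v = step S (reach S u k) v

endpoints : ∀ {n} → List (Edge n) → List (Fin n)
endpoints S = concatMap (λ { (a , b) → a ∷ b ∷ [] }) S

-- The subgraph induced by S is connected: any two of its vertices are joined
-- by a walk in S (walks of length ≤ n suffice on n vertices).
connected : ∀ {n} → List (Edge n) → Bool
connected {n} S = all (λ u → all (λ v → reach S u n v) (endpoints S)) (endpoints S)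

isCEC : ∀ {n} → List (Edge n) → Bool
isCEC S = covers S ∧ connected S

ec : ∀ {n} → Graph n → ℕ → ℕ
ec G i = length (filterᵇ (λ S → (length S ≡ᵇ i) ∧ isCEC S) (sublists (edges G)))

-- E_c(G,x) = Σ_{i=1}^{m} e_c(G,i) x^i, represented by its coefficient
-- sequence; equality of polynomials is equality of all coefficients.
-- (Coefficients with i > m are 0 automatically; the i = 0 coefficient is 0 by
-- definition of E_c, so only i ≥ 1 is compared.)
SameEc : ∀ {n} → Graph n → Graph n → Set
SameEc G H = ∀ i → 1 Data.Nat.≤ i → ec G i ≡ ec H i
  where import Data.Nat

{-# OPTIONS --safe #-}
module Submission where

-- E(G) is a sublist of E(K_n). The whole edge set of K_n is a connected edge
-- cover of size N = |E(K_n)|, so e_c(K_n, N) ≥ 1, hence e_c(G, N) ≥ 1 and G has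
-- at least N edges. A sublist that is at least as long as the list is the list
-- itself, so E(G) = E(K_n).

open import Defs
open import Data.Nat using (ℕ)
open import Relation.Binary.PropositionalEquality using (_≡_; _≢_)
open import Data.Bool using (true)
open import Data.Fin using (Fin)

open import Data.Bool using (Bool; T; T?; _∧_)
open import Data.Bool.Properties using (T-≡; T-∧; T-∨)
open import Data.Bool.ListAction using (any; all)
open import Data.Empty using (⊥-elim)
open import Data.Fin using (_<_; _<?_; _≟_)
open import Data.Fin.Properties using (<-cmp)
open import Data.List using (List; []; _∷_; map; length; concatMap; filterᵇ; allFin)
open import Data.List.Membership.Propositional using (_∈_; lose)
open import Data.List.Membership.Propositional.Properties
  using ( ∈-++⁻; ∈-++⁺ʳ; ∈-map⁺; ∈-map⁻; ∈-filter⁺; ∈-filter⁻; ∈-concat⁺′; ∈-concat⁻′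
        ; ∈-allFin; ∈-length)
open import Data.List.Relation.Binary.Pointwise using (Pointwise-≡⇒≡)
open import Data.List.Relation.Binary.Sublist.Propositional using (_⊆_; []; _∷_; _∷ʳ_; ⊆-refl)
open import Data.List.Relation.Binary.Sublist.Propositional.Properties
  using (++⁺; map⁺; filter⁺; length-mono-≤; to-≋)
open import Data.List.Relation.Unary.All using (tabulate)
open import Data.List.Relation.Unary.All.Properties using (all⁻)
open import Data.List.Relation.Unary.Any using (here)
open import Data.List.Relation.Unary.Any.Properties using (any⁺)
open import Data.Nat using (zero; suc; _≤_; _≡ᵇ_) renaming (_<_ to _<ℕ_)
open import Data.Nat.Properties using (≤-antisym; ≡ᵇ⇒≡; ≡⇒≡ᵇ)
open import Data.Product using (_,_; proj₁; proj₂; ∃-syntax)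
open import Data.Sum using (_⊎_; inj₁; inj₂; [_,_]′)
open import Function using (_∘_; Equivalence)
open import Relation.Binary using (tri<; tri≈; tri>)
open import Relation.Binary.PropositionalEquality using (refl; sym; subst)
open import Relation.Nullary using (yes; no)
open import Relation.Nullary.Decidable using (⌊_⌋; fromWitness; fromWitnessFalse)

open Equivalence using (to; from)

private
  variable
    A B : Set
    n : ℕ

all-true : (p : A → Bool) (xs : List A) → (∀ x → T (p x)) → T (all p xs)
all-true p xs h = all⁻ p {xs} (tabulate (λ {x} _ → h x))

nonempty⇒∃∈ : {xs : List A} → 0 <ℕ length xs → ∃[ x ] x ∈ xs
nonempty⇒∃∈ {xs = x ∷ _} _ = x , here refl

concatMap⁺ : (f g : A → List B) → (∀ x → f x ⊆ g x) → (xs : List A) →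
  concatMap f xs ⊆ concatMap g xs
concatMap⁺ f g f⊆g []       = []
concatMap⁺ f g f⊆g (x ∷ xs) = ++⁺ (f⊆g x) (concatMap⁺ f g f⊆g xs)

⊆∧length-≥⇒≡ : {xs ys : List A} → xs ⊆ ys → length ys ≤ length xs → xs ≡ ys
⊆∧length-≥⇒≡ xs⊆ys ys≤xs =
  Pointwise-≡⇒≡ (to-≋ (≤-antisym (length-mono-≤ xs⊆ys) ys≤xs) xs⊆ys)

∈-sublists⁻ : {S xs : List A} → S ∈ sublists xs → S ⊆ xs
∈-sublists⁻ {xs = []}     (here refl) = []
∈-sublists⁻ {xs = x ∷ xs} S∈ with ∈-++⁻ (sublists xs) S∈
... | inj₁ S∈ˡ = x ∷ʳ ∈-sublists⁻ S∈ˡ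
... | inj₂ S∈ʳ with ∈-map⁻ (x ∷_) S∈ʳ
...   | S′ , S′∈ , refl = refl ∷ ∈-sublists⁻ S′∈

∈-sublists-self : (xs : List A) → xs ∈ sublists xs
∈-sublists-self []       = here refl
∈-sublists-self (x ∷ xs) = ∈-++⁺ʳ (sublists xs) (∈-map⁺ (x ∷_) (∈-sublists-self xs))

==-refl : (x : Fin n) → T (x == x)
==-refl x = fromWitness refl

adj⇒≢ : (G : Graph n) {x y : Fin n} → T (adj G x y) → x ≢ y
adj⇒≢ G {x} x~x refl = subst T (adj-irref G x) x~x

≢⇒adj-K : {x y : Fin n} → x ≢ y → T (adj (K n) x y)
≢⇒adj-K = fromWitnessFalse

-- `edges G` is definitionally `concatMap (edgesFrom G) (allFin n)`.
isEdgeFrom : Graph n → Fin n → Fin n → Bool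
isEdgeFrom G u v = ⌊ u <? v ⌋ ∧ adj G u v

edgesFrom : Graph n → Fin n → List (Edge n)
edgesFrom {n} G u = map (u ,_) (filterᵇ (isEdgeFrom G u) (allFin n))

∈-edges⁺ : (G : Graph n) {x y : Fin n} → x < y → T (adj G x y) → (x , y) ∈ edges G
∈-edges⁺ {n} G {x} {y} x<y x~y =
  ∈-concat⁺′ (∈-map⁺ (x ,_) y∈above-x) (∈-map⁺ (edgesFrom G) (∈-allFin x))
  where
  y∈above-x : y ∈ filterᵇ (isEdgeFrom G x) (allFin n)
  y∈above-x = ∈-filter⁺ (T? ∘ isEdgeFrom G x) (∈-allFin y) (from T-∧ (fromWitness x<y , x~y))

∈-edges⁻ : (G : Graph n) {x y : Fin n} → (x , y) ∈ edges G → T (adj G x y)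
∈-edges⁻ {n} G e∈ with ∈-concat⁻′ (map (edgesFrom G) (allFin n)) e∈
... | es , e∈es , es∈ with ∈-map⁻ (edgesFrom G) es∈
...   | u , _ , refl with ∈-map⁻ (u ,_) e∈es
...     | v , v∈ , refl with ∈-filter⁻ (T? ∘ isEdgeFrom G u) {xs = allFin n} v∈
...       | _ , u<v∧u~v = proj₂ (to T-∧ u<v∧u~v)

adj⇒∈-edges : (G : Graph n) {x y : Fin n} → T (adj G x y) →
  (x , y) ∈ edges G ⊎ (y , x) ∈ edges G
adj⇒∈-edges G {x} {y} x~y with <-cmp x y
... | tri< x<y _ _ = inj₁ (∈-edges⁺ G x<y x~y)
... | tri≈ _ x≡y _ = ⊥-elim (adj⇒≢ G x~y x≡y)
... | tri> _ _ y<x = inj₂ (∈-edges⁺ G y<x (subst T (adj-sym G x y) x~y))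

∈-edges⇒adj : (G : Graph n) {x y : Fin n} →
  (x , y) ∈ edges G ⊎ (y , x) ∈ edges G → T (adj G x y)
∈-edges⇒adj G (inj₁ xy∈) = ∈-edges⁻ G xy∈
∈-edges⇒adj G {x} {y} (inj₂ yx∈) = subst T (adj-sym G y x) (∈-edges⁻ G yx∈)

edges-⊆-K : (G : Graph n) → edges G ⊆ edges (K n)
edges-⊆-K {n} G =
  concatMap⁺ (edgesFrom G) (edgesFrom (K n)) (λ u → map⁺ (u ,_) (above-⊆ u)) (allFin n)
  where
  weaken : ∀ u {v w : Fin n} → v ≡ w → T (isEdgeFrom G u v) → T (isEdgeFrom (K n) u w)
  weaken u refl u<v∧u~v with to T-∧ u<v∧u~v
  ... | u<v , u~v = from T-∧ (u<v , ≢⇒adj-K (adj⇒≢ G u~v))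
  above-⊆ : ∀ u → filterᵇ (isEdgeFrom G u) (allFin n) ⊆ filterᵇ (isEdgeFrom (K n) u) (allFin n)
  above-⊆ u =
    filter⁺ (T? ∘ isEdgeFrom G u) (T? ∘ isEdgeFrom (K n) u) (weaken u) (⊆-refl {x = allFin n})

reach-refl : (S : List (Edge n)) (u : Fin n) (k : ℕ) → T (reach S u k u)
reach-refl S u zero    = ==-refl u
reach-refl S u (suc k) = from T-∨ (inj₁ (reach-refl S u k))

reach-edge : (S : List (Edge n)) {u v : Fin n} (k : ℕ) →
  (u , v) ∈ S ⊎ (v , u) ∈ S → T (reach S u (suc k) v)
reach-edge S {u} {v} k (inj₁ uv∈) =
  from T-∨ (inj₂ (any⁺ _ (lose uv∈ (from T-∨ (inj₂ (from T-∧ (==-refl v , reach-refl S u k)))))))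
reach-edge S {u} {v} k (inj₂ vu∈) =
  from T-∨ (inj₂ (any⁺ _ (lose vu∈ (from T-∨ (inj₁ (from T-∧ (==-refl v , reach-refl S u k)))))))

K-reach : (u v : Fin n) → T (reach (edges (K n)) u n v)
K-reach {suc m} u v with u ≟ v
... | yes refl = reach-refl _ u (suc m)
... | no u≢v   = reach-edge _ m (adj⇒∈-edges (K (suc m)) (≢⇒adj-K u≢v))

K-connected : T (connected (edges (K n)))
K-connected {n} = all-true _ S (λ u → all-true _ S (λ v → K-reach u v))
  where S = endpoints (edges (K n))

-- x ≢ y forces n ≥ 2, so that every vertex has a neighbour.
K-covers : {x y : Fin n} → x ≢ y → T (covers (edges (K n)))
K-covers {n} {x} {y} x≢y = all-true _ (allFin n) covered
  where
  incident-to : (w z : Fin n) → (w , z) ∈ edges (K n) ⊎ (z , w) ∈ edges (K n) →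
    T (any (λ e → incident e w) (edges (K n)))
  incident-to w z (inj₁ wz∈) = any⁺ _ (lose wz∈ (from T-∨ (inj₁ (==-refl w))))
  incident-to w z (inj₂ zw∈) = any⁺ _ (lose zw∈ (from T-∨ (inj₂ (==-refl w))))
  covered : ∀ w → T (any (λ e → incident e w) (edges (K n)))
  covered w with w ≟ x
  ... | yes refl = incident-to w y (adj⇒∈-edges (K n) (≢⇒adj-K x≢y))
  ... | no w≢x   = incident-to w x (adj⇒∈-edges (K n) (≢⇒adj-K w≢x))

K-isCEC : {x y : Fin n} → x ≢ y → T (isCEC (edges (K n)))
K-isCEC {n} x≢y = from T-∧ (K-covers x≢y , K-connected {n})

isCECOfSize : ℕ → List (Edge n) → Bool
isCECOfSize i S = (length S ≡ᵇ i) ∧ isCEC S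

ec-pos⇒≤-edges : (G : Graph n) (i : ℕ) → 0 <ℕ ec G i → i ≤ length (edges G)
ec-pos⇒≤-edges G i pos with nonempty⇒∃∈ pos
... | S , S∈ with ∈-filter⁻ (T? ∘ isCECOfSize i) {xs = sublists (edges G)} S∈
...   | S∈sublists , size≡ᵇi∧cec =
  subst (_≤ length (edges G)) (≡ᵇ⇒≡ (length S) i (proj₁ (to T-∧ size≡ᵇi∧cec)))
        (length-mono-≤ (∈-sublists⁻ {xs = edges G} S∈sublists))

isCEC⇒ec-pos : (G : Graph n) {S : List (Edge n)} → S ∈ sublists (edges G) → T (isCEC S) →
  0 <ℕ ec G (length S)
isCEC⇒ec-pos G {S} S∈ cec =
  ∈-length (∈-filter⁺ (T? ∘ isCECOfSize (length S)) S∈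
                      (from T-∧ (≡⇒≡ᵇ (length S) (length S) refl , cec)))

SameEc-K⇒edges≡ : (G : Graph n) → SameEc G (K n) → {x y : Fin n} → x ≢ y →
  edges G ≡ edges (K n)
SameEc-K⇒edges≡ {n} G same {x} {y} x≢y = ⊆∧length-≥⇒≡ (edges-⊆-K G) N≤size-G
  where
  N : ℕ
  N = length (edges (K n))
  1≤N : 1 ≤ N
  1≤N = [ ∈-length , ∈-length ]′ (adj⇒∈-edges (K n) (≢⇒adj-K x≢y))
  ec-K-pos : 0 <ℕ ec (K n) N
  ec-K-pos = isCEC⇒ec-pos (K n) (∈-sublists-self (edges (K n))) (K-isCEC x≢y)
  N≤size-G : N ≤ length (edges G)
  N≤size-G = ec-pos⇒≤-edges G N (subst (0 <ℕ_) (sym (same N 1≤N)) ec-K-pos)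

mainTheorem3 : (n : ℕ) (G : Graph n) → SameEc G (K n) →
    ∀ (u v : Fin n) → u ≢ v → adj G u v ≡ true
mainTheorem3 n G same u v u≢v =
  to T-≡ (∈-edges⇒adj G (subst (λ E → (u , v) ∈ E ⊎ (v , u) ∈ E)
                                (sym (SameEc-K⇒edges≡ G same u≢v))
                                (adj⇒∈-edges (K n) (≢⇒adj-K u≢v))))
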